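{- For every integer $k$ with $-1\le k\le 14$ one has $F(4,\,6+4k,\,87-4k)=89$, and for every integer $k$ with $0\le k\le 7$ one has $F(9,\,3+9k,\,85-9k)=167$.
   Context: For positive integers $d_1,\dots,d_m$ with $\gcd(d_1,\dots,d_m)=1$, ${\sf S}(d_1,\dots,d_m)=\{\sum_{i=1}^m x_id_i : x_i\in\mathbb{Z}_{\ge 0}\}$ is the numerical semigroup they generate, and the Frobenius number $F(d_1,\dots,d_m)$ is the largest positive integer not belonging to ${\sf S}(d_1,\dots,d_m)$ (i.e. not representable as a nonnegative integer combination of $d_1,\dots,d_m$). The generating tuple need not be minimal (e.g. for $k=-1$ the first tuple is $\{4,2,91\}$). -}

module Defs where

open import Data.Nat using (ℕ)
open import Data.Integer using (ℤ; +_; _+_; _*_; _<_; _≤_)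
open import Data.Product using (Σ; _×_)
open import Relation.Binary.PropositionalEquality using (_≡_)
open import Relation.Nullary using (¬_)

InS3 : ℤ → ℤ → ℤ → ℤ → Set
InS3 d₁ d₂ d₃ n =
  Σ ℕ λ x₁ → Σ ℕ λ x₂ → Σ ℕ λ x₃ → (+ x₁) * d₁ + (+ x₂) * d₂ + (+ x₃) * d₃ ≡ n

IsFrobenius3 : ℤ → ℤ → ℤ → ℤ → Set
IsFrobenius3 d₁ d₂ d₃ f =
  (+ 0 < f) × ¬ InS3 d₁ d₂ d₃ f × (∀ n → f < n → InS3 d₁ d₂ d₃ n)

module Submission where

-- Proof strategy.  Work with natural numbers: n ∈ S(d₁,d₂,d₃) is the
-- statement `Rep n` that n = x₁d₁ + x₂d₂ + x₃d₃ for some x₁,x₂,x₃ ∈ ℕ.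
--
-- Rep n holds iff some partial sum s = x₂d₂ + x₃d₃ with
--    x₂ ≤ n/d₂, x₃ ≤ n/d₃ satisfies s ≤ n and d₁ ∣ n - s.  The right-hand
--    side is a bounded search, so Rep is decidable (`rep?`).
-- 2. Frobenius criterion.  S is closed under adding d₁; hence if the d₁
--    consecutive integers f+1, …, f+d₁ lie in S, so does every m > f.
--    Thus f is the Frobenius number as soon as f ∉ S and those d₁
--    integers are in S — finitely many facts, each settled by `rep?`.
-- 3. Transfer.
-- The theorem is then a case analysis over the 16 + 8 admissible values
-- of k, each discharged by running the decision procedure.

open import Defs
open import Data.Nat as ℕ
  using (ℕ; suc; _∸_; s≤s; NonZero; >-nonZero⁻¹)
open import Data.Nat.Properties
  using (+-assoc; m≤m+n; m≤n+m; m+n∸n≡m; m∸n+n≡m; m+[n∸m]≡n; ≤-trans; anyUpTo?; allUpTo?)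
  renaming (_≤?_ to _≤ℕ?_)
open import Data.Nat.DivMod using (_%_; _/_; m≡m%n+[m/n]*n; m%n<n; m*n/n≡m; /-monoˡ-≤)
open import Data.Nat.Divisibility using (_∣_; divides; _∣?_)
open import Data.Integer as ℤ using (ℤ; +_; -[1+_]; -_; _+_; _-_; _*_; _≤_; +<+; +≤+; -≤-)
open import Data.Integer.Properties using (pos-+; pos-*; +-injective)
open import Data.Product using (Σ; ∃; _×_; _,_)
open import Data.Unit using (tt)
open import Relation.Nullary using (¬_; Dec)
open import Relation.Nullary.Decidable using (map′; _×-dec_; True; False; toWitness; toWitnessFalse)
open import Relation.Binary.PropositionalEquality
open import Data.Nat.Solver using (module +-*-Solver)
open +-*-Solver using (solve; _:+_; _:*_; _:=_)

module Representation (d₁ d₂ d₃ : ℕ) where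

  Rep : ℕ → Set
  Rep n = Σ ℕ λ x₁ → Σ ℕ λ x₂ → Σ ℕ λ x₃ → x₁ ℕ.* d₁ ℕ.+ x₂ ℕ.* d₂ ℕ.+ x₃ ℕ.* d₃ ≡ n

  partialSum : ℕ → ℕ → ℕ
  partialSum x₂ x₃ = x₂ ℕ.* d₂ ℕ.+ x₃ ℕ.* d₃

  Completes : ℕ → ℕ → Set
  Completes n s = s ℕ.≤ n × d₁ ∣ n ∸ s

  BoundedRep : ℕ → .{{NonZero d₂}} → .{{NonZero d₃}} → Set
  BoundedRep n = ∃ λ x₂ → x₂ ℕ.< suc (n / d₂) ×
                   ∃ λ x₃ → x₃ ℕ.< suc (n / d₃) × Completes n (partialSum x₂ x₃)

  bounded⇒rep : ∀ n .{{_ : NonZero d₂}} .{{_ : NonZero d₃}} → BoundedRep n → Rep n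
  bounded⇒rep n (x₂ , _ , x₃ , _ , s≤n , divides q n∸s≡q*d₁) = q , x₂ , x₃ , (begin
    q ℕ.* d₁ ℕ.+ x₂ ℕ.* d₂ ℕ.+ x₃ ℕ.* d₃ ≡⟨ +-assoc (q ℕ.* d₁) _ _ ⟩
    q ℕ.* d₁ ℕ.+ s                       ≡⟨ cong (ℕ._+ s) (sym n∸s≡q*d₁) ⟩
    n ∸ s ℕ.+ s                          ≡⟨ m∸n+n≡m s≤n ⟩
    n                                    ∎)
    where open ≡-Reasoning
          s = partialSum x₂ x₃

  -- In any representation, xᵢdᵢ ≤ n forces xᵢ ≤ n / dᵢ, and n - (x₂d₂ + x₃d₃) = x₁d₁.
  rep⇒bounded : ∀ n .{{_ : NonZero d₂}} .{{_ : NonZero d₃}} → Rep n → BoundedRep n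
  rep⇒bounded n (x₁ , x₂ , x₃ , eq) =
    x₂ , s≤s (coefficientBound x₂ d₂ (≤-trans (m≤m+n _ _) s≤n)) ,
    x₃ , s≤s (coefficientBound x₃ d₃ (≤-trans (m≤n+m _ _) s≤n)) ,
    s≤n , divides x₁ n∸s≡x₁*d₁
    where
      s = partialSum x₂ x₃
      x₁d₁+s≡n : x₁ ℕ.* d₁ ℕ.+ s ≡ n
      x₁d₁+s≡n = trans (sym (+-assoc (x₁ ℕ.* d₁) _ _)) eq
      s≤n : s ℕ.≤ n
      s≤n = subst (s ℕ.≤_) x₁d₁+s≡n (m≤n+m s (x₁ ℕ.* d₁))
      n∸s≡x₁*d₁ : n ∸ s ≡ x₁ ℕ.* d₁
      n∸s≡x₁*d₁ = trans (cong (_∸ s) (sym x₁d₁+s≡n)) (m+n∸n≡m (x₁ ℕ.* d₁) s)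
      coefficientBound : ∀ x d .{{_ : NonZero d}} → x ℕ.* d ℕ.≤ n → x ℕ.≤ n / d
      coefficientBound x d xd≤n = subst (ℕ._≤ n / d) (m*n/n≡m x d) (/-monoˡ-≤ d xd≤n)

  rep? : ∀ n .{{_ : NonZero d₂}} .{{_ : NonZero d₃}} → Dec (Rep n)
  rep? n = map′ (bounded⇒rep n) (rep⇒bounded n)
    (anyUpTo? (λ x₂ → anyUpTo? (λ x₃ → completes? (partialSum x₂ x₃)) (suc (n / d₃)))
              (suc (n / d₂)))
    where
      completes? : ∀ s → Dec (Completes n s)
      completes? s = s ≤ℕ? n ×-dec d₁ ∣? (n ∸ s)

  rep-+-multiple : ∀ m q → Rep m → Rep (m ℕ.+ q ℕ.* d₁)
  rep-+-multiple m q (x₁ , x₂ , x₃ , eq) = x₁ ℕ.+ q , x₂ , x₃ ,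
    trans (solve 7 (λ x₁ q d₁ x₂ d₂ x₃ d₃ →
                      (x₁ :+ q) :* d₁ :+ x₂ :* d₂ :+ x₃ :* d₃
                        := (x₁ :* d₁ :+ x₂ :* d₂ :+ x₃ :* d₃) :+ q :* d₁)
                   refl x₁ q d₁ x₂ d₂ x₃ d₃)
          (cong (ℕ._+ q ℕ.* d₁) eq)

  -- If f+1, …, f+d₁ are representable, so is every m > f: write
  -- m = (f+1 + k % d₁) + (k / d₁)·d₁ with k = m - (f+1).
  rep-above : ∀ f .{{_ : NonZero d₁}} →
              (∀ {r} → r ℕ.< d₁ → Rep (suc f ℕ.+ r)) → ∀ m → f ℕ.< m → Rep m
  rep-above f window m f<m =
    subst Rep m≡ (rep-+-multiple (suc f ℕ.+ k % d₁) (k / d₁) (window (m%n<n k d₁)))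
    where
      k = m ∸ suc f
      open ≡-Reasoning
      m≡ : suc f ℕ.+ k % d₁ ℕ.+ (k / d₁) ℕ.* d₁ ≡ m
      m≡ = begin
        suc f ℕ.+ k % d₁ ℕ.+ (k / d₁) ℕ.* d₁  ≡⟨ +-assoc (suc f) (k % d₁) _ ⟩
        suc f ℕ.+ (k % d₁ ℕ.+ (k / d₁) ℕ.* d₁) ≡⟨ cong (suc f ℕ.+_) (sym (m≡m%n+[m/n]*n k d₁)) ⟩
        suc f ℕ.+ k                            ≡⟨ m+[n∸m]≡n f<m ⟩
        m                                      ∎

  combination-ℕ→ℤ : ∀ x₁ x₂ x₃ →
    (+ x₁) * (+ d₁) + (+ x₂) * (+ d₂) + (+ x₃) * (+ d₃)
      ≡ + (x₁ ℕ.* d₁ ℕ.+ x₂ ℕ.* d₂ ℕ.+ x₃ ℕ.* d₃)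
  combination-ℕ→ℤ x₁ x₂ x₃ = begin
    (+ x₁) * (+ d₁) + (+ x₂) * (+ d₂) + (+ x₃) * (+ d₃)
      ≡⟨ cong₂ _+_ (cong₂ _+_ (sym (pos-* x₁ d₁)) (sym (pos-* x₂ d₂))) (sym (pos-* x₃ d₃)) ⟩
    + (x₁ ℕ.* d₁) + + (x₂ ℕ.* d₂) + + (x₃ ℕ.* d₃)
      ≡⟨ cong (_+ + (x₃ ℕ.* d₃)) (sym (pos-+ (x₁ ℕ.* d₁) (x₂ ℕ.* d₂))) ⟩
    + (x₁ ℕ.* d₁ ℕ.+ x₂ ℕ.* d₂) + + (x₃ ℕ.* d₃)
      ≡⟨ sym (pos-+ (x₁ ℕ.* d₁ ℕ.+ x₂ ℕ.* d₂) (x₃ ℕ.* d₃)) ⟩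
    + (x₁ ℕ.* d₁ ℕ.+ x₂ ℕ.* d₂ ℕ.+ x₃ ℕ.* d₃) ∎
    where open ≡-Reasoning

  inS3⇒rep : ∀ n → InS3 (+ d₁) (+ d₂) (+ d₃) (+ n) → Rep n
  inS3⇒rep n (x₁ , x₂ , x₃ , eq) =
    x₁ , x₂ , x₃ , +-injective (trans (sym (combination-ℕ→ℤ x₁ x₂ x₃)) eq)

  rep⇒inS3 : ∀ n → Rep n → InS3 (+ d₁) (+ d₂) (+ d₃) (+ n)
  rep⇒inS3 n (x₁ , x₂ , x₃ , eq) = x₁ , x₂ , x₃ , trans (combination-ℕ→ℤ x₁ x₂ x₃) (cong +_ eq)

  frobenius-criterion : ∀ f .{{_ : NonZero f}} .{{_ : NonZero d₁}} → ¬ Rep f →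
    (∀ {r} → r ℕ.< d₁ → Rep (suc f ℕ.+ r)) → IsFrobenius3 (+ d₁) (+ d₂) (+ d₃) (+ f)
  frobenius-criterion f f∉S window =
    +<+ (>-nonZero⁻¹ f) , (λ f∈S → f∉S (inS3⇒rep f f∈S)) , above
    where
      above : ∀ n → + f ℤ.< n → InS3 (+ d₁) (+ d₂) (+ d₃) n
      above (+ m) (+<+ f<m) = rep⇒inS3 m (rep-above f window m f<m)

  frobenius-by-decision : ∀ f .{{_ : NonZero f}} .{{_ : NonZero d₁}}
    .{{_ : NonZero d₂}} .{{_ : NonZero d₃}} →
    False (rep? f) → True (allUpTo? (λ r → rep? (suc f ℕ.+ r)) d₁) →
    IsFrobenius3 (+ d₁) (+ d₂) (+ d₃) (+ f)
  frobenius-by-decision f f∉S window =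
    frobenius-criterion f (toWitnessFalse f∉S) (toWitness window)

open Representation using (frobenius-by-decision)

family₁ : (k : ℤ) → - (+ 1) ≤ k → k ≤ + 14 →
          IsFrobenius3 (+ 4) (+ 6 + + 4 * k) (+ 87 - + 4 * k) (+ 89)
family₁ -[1+ 0 ] _ _ = frobenius-by-decision 4 2 91 89 tt tt
family₁ -[1+ suc _ ] (-≤- ()) _
family₁ (+ 0)  _ _ = frobenius-by-decision 4 6 87 89 tt tt
family₁ (+ 1)  _ _ = frobenius-by-decision 4 10 83 89 tt tt
family₁ (+ 2)  _ _ = frobenius-by-decision 4 14 79 89 tt tt
family₁ (+ 3)  _ _ = frobenius-by-decision 4 18 75 89 tt tt
family₁ (+ 4)  _ _ = frobenius-by-decision 4 22 71 89 tt tt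
family₁ (+ 5)  _ _ = frobenius-by-decision 4 26 67 89 tt tt
family₁ (+ 6)  _ _ = frobenius-by-decision 4 30 63 89 tt tt
family₁ (+ 7)  _ _ = frobenius-by-decision 4 34 59 89 tt tt
family₁ (+ 8)  _ _ = frobenius-by-decision 4 38 55 89 tt tt
family₁ (+ 9)  _ _ = frobenius-by-decision 4 42 51 89 tt tt
family₁ (+ 10) _ _ = frobenius-by-decision 4 46 47 89 tt tt
family₁ (+ 11) _ _ = frobenius-by-decision 4 50 43 89 tt tt
family₁ (+ 12) _ _ = frobenius-by-decision 4 54 39 89 tt tt
family₁ (+ 13) _ _ = frobenius-by-decision 4 58 35 89 tt tt
family₁ (+ 14) _ _ = frobenius-by-decision 4 62 31 89 tt tt
family₁ (+ suc (suc (suc (suc (suc (suc (suc (suc (suc (suc (suc (suc (suc (suc (suc _))))))))))))))) _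
  (+≤+ (s≤s (s≤s (s≤s (s≤s (s≤s (s≤s (s≤s (s≤s (s≤s (s≤s (s≤s (s≤s (s≤s (s≤s ())))))))))))))))

family₂ : (k : ℤ) → + 0 ≤ k → k ≤ + 7 →
          IsFrobenius3 (+ 9) (+ 3 + + 9 * k) (+ 85 - + 9 * k) (+ 167)
family₂ -[1+ _ ] () _
family₂ (+ 0) _ _ = frobenius-by-decision 9 3 85 167 tt tt
family₂ (+ 1) _ _ = frobenius-by-decision 9 12 76 167 tt tt
family₂ (+ 2) _ _ = frobenius-by-decision 9 21 67 167 tt tt
family₂ (+ 3) _ _ = frobenius-by-decision 9 30 58 167 tt tt
family₂ (+ 4) _ _ = frobenius-by-decision 9 39 49 167 tt tt
family₂ (+ 5) _ _ = frobenius-by-decision 9 48 40 167 tt tt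
family₂ (+ 6) _ _ = frobenius-by-decision 9 57 31 167 tt tt
family₂ (+ 7) _ _ = frobenius-by-decision 9 66 22 167 tt tt
family₂ (+ suc (suc (suc (suc (suc (suc (suc (suc _)))))))) _
  (+≤+ (s≤s (s≤s (s≤s (s≤s (s≤s (s≤s (s≤s ()))))))))

mainTheorem1 : ((k : ℤ) → - (+ 1) ≤ k → k ≤ + 14 →
                 IsFrobenius3 (+ 4) (+ 6 + + 4 * k) (+ 87 - + 4 * k) (+ 89))
               × ((k : ℤ) → + 0 ≤ k → k ≤ + 7 →
                 IsFrobenius3 (+ 9) (+ 3 + + 9 * k) (+ 85 - + 9 * k) (+ 167))
mainTheorem1 = family₁ , family₂
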